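{- Let $G$ be a $2$-connected graph, $v\in V(G)$ and $f\colon V(G)\to\{1,0,\hat{0}\}$ a colouring. For $i\in\{1,0,\hat 0\}$ let $S_{v=i}$ be a minimum-size $f_{v=i}$-respecting simultaneous dominating set of $G$. Then 1. $|S_{v=0}|\le |S_{v=\hat 0}|\le |S_{v=1}|$, and 2. $|S_{v=1}|-|S_{v=0}|\le 1$.
   Context: All graphs are finite, simple and undirected; a graph is $2$-connected if it has no cut vertex. For a connected graph $G$ and $S\subseteq V(G)$, a vertex $w$ is simultaneously dominated by $S$ if in every spanning tree $T$ of $G$, $w\in S$ or $w$ has a neighbour in $T$ belonging to $S$. For a colouring $f\colon V(G)\to\{1,0,\hat 0\}$, a set $S\subseteq V(G)$ is an $f$-respecting simultaneous dominating set if $f^{ -1}(1)\subseteq S$ and every vertex of $f^{ -1}(\hat 0)$ is simultaneously dominated by $S$. For $i\in\{1,0,\hat0\}$, $f_{v=i}$ denotes the colouring with $f_{v=i}(v)=i$ and $f_{v=i}(w)=f(w)$ for $w\neq v$. -}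

module Defs where

open import Data.Nat using (ℕ; _≤_)
open import Data.Fin using (Fin)
open import Data.Fin.Properties using (_≟_)
open import Data.Fin.Subset using (Subset; _∈_; ∣_∣)
open import Data.Bool using (Bool; true; false; T)
open import Data.List using (List; []; _∷_; length)
open import Data.List.Relation.Unary.All using (All)
open import Data.List.Relation.Unary.Unique.Propositional using (Unique)
open import Data.Product using (Σ; ∃; _×_)
open import Data.Sum using (_⊎_)
open import Relation.Binary.PropositionalEquality using (_≡_; _≢_)
open import Relation.Nullary using (¬_; yes; no)

record Graph (n : ℕ) : Set where
  field
    adj    : Fin n → Fin n → Bool
    symm   : ∀ u v → adj u v ≡ adj v u
    irrefl : ∀ u → adj u u ≡ false

Adj : ∀ {n} → Graph n → Fin n → Fin n → Set
Adj G u v = T (Graph.adj G u v)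

data Walk {n : ℕ} (G : Graph n) : Fin n → Fin n → Set where
  []  : ∀ {u} → Walk G u u
  _∷_ : ∀ {u v w} → Adj G u v → Walk G v w → Walk G u w

vertices : ∀ {n} {G : Graph n} {u w : Fin n} → Walk G u w → List (Fin n)
vertices {u = u} []      = u ∷ []
vertices {u = u} (_ ∷ p) = u ∷ vertices p

Connected : ∀ {n} → Graph n → Set
Connected G = ∀ u w → Walk G u w

NoCutVertex : ∀ {n} → Graph n → Set
NoCutVertex G = ∀ v u w → u ≢ v → w ≢ v →
  Σ (Walk G u w) λ p → All (λ x → x ≢ v) (vertices p)

TwoConnected : ∀ {n} → Graph n → Set
TwoConnected G = Connected G × NoCutVertex G

HasCycle : ∀ {n} → Graph n → Set
HasCycle G = ∃ λ u → ∃ λ w → Σ (Walk G u w) λ p →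
  Unique (vertices p) × (3 ≤ length (vertices p)) × Adj G w u

Acyclic : ∀ {n} → Graph n → Set
Acyclic G = ¬ HasCycle G

IsSpanningTree : ∀ {n} → Graph n → Graph n → Set
IsSpanningTree G T′ = (∀ u v → Adj T′ u v → Adj G u v) × Connected T′ × Acyclic T′

SimDominated : ∀ {n} → Graph n → Subset n → Fin n → Set
SimDominated {n} G S w = (T′ : Graph n) → IsSpanningTree G T′ →
  (w ∈ S) ⊎ (∃ λ u → Adj T′ w u × u ∈ S)

data Colour : Set where
  c1 c0 c0̂ : Colour

Colouring : ℕ → Set
Colouring n = Fin n → Colour

update : ∀ {n} → Colouring n → Fin n → Colour → Colouring n
update f v i w with w ≟ v
... | yes _ = i
... | no  _ = f w

Respecting : ∀ {n} → Graph n → Colouring n → Subset n → Set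
Respecting G f S =
  (∀ w → f w ≡ c1 → w ∈ S) × (∀ w → f w ≡ c0̂ → SimDominated G S w)

IsMinimumRespecting : ∀ {n} → Graph n → Colouring n → Subset n → Set
IsMinimumRespecting {n} G f S =
  Respecting G f S × ((S′ : Subset n) → Respecting G f S′ → ∣ S ∣ ≤ ∣ S′ ∣)

module Submission where

-- Order the colours by how much they demand of a
-- respecting set: 0 ⊑ 0̂ ⊑ 1 (colour 0 demands nothing, 0̂ demands
-- simultaneous domination, 1 demands membership, which implies domination).
-- A set respecting a colouring g then respects every colouring f ⊑ g
-- pointwise, so minimum respecting sets grow with the colouring; since
-- f_{v=0} ⊑ f_{v=0̂} ⊑ f_{v=1}, this gives part 1.  For part 2, adding v to
-- any f_{v=i}-respecting set yields an f_{v=1}-respecting set (simultaneous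
-- domination is monotone in the dominating set), and it has at most one
-- more element, so |S_{v=1}| ≤ |S_{v=0}| + 1.
-- Neither argument uses 2-connectivity; the lemma holds for every graph.

open import Defs
open import Data.Nat using (ℕ; _≤_; _∸_; _+_; suc; z≤n; s≤s)
open import Data.Nat.Properties
  using (≤-trans; ≤-reflexive; n≤1+n; +-suc; +-monoʳ-≤; m≤n+o⇒m∸n≤o)
open import Data.Fin using (Fin)
open import Data.Fin.Properties using (_≟_)
open import Data.Fin.Subset using (Subset; ∣_∣; _∪_; ⁅_⁆; _∈_; _⊆_; inside; outside)
open import Data.Fin.Subset.Properties using (p⊆p∪q; x∈p∪q⁺; x∈⁅x⁆; ∣⁅x⁆∣≡1)
open import Data.Vec using (_∷_; [])
open import Data.Product using (_×_; _,_; proj₁; proj₂)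
open import Data.Sum using (_⊎_; inj₁; inj₂)
open import Relation.Binary.PropositionalEquality using (_≡_; refl; sym; trans; subst)
open import Relation.Nullary using (yes; no)

data _⊑_ : Colour → Colour → Set where
  ⊑-refl : ∀ {i} → i ⊑ i
  0⊑     : ∀ {i} → c0 ⊑ i
  0̂⊑1    : c0̂ ⊑ c1

⊑-from-1 : ∀ {i j} → i ⊑ j → i ≡ c1 → j ≡ c1
⊑-from-1 ⊑-refl e = e
⊑-from-1 0⊑     ()
⊑-from-1 0̂⊑1    ()

⊑-from-0̂ : ∀ {i j} → i ⊑ j → i ≡ c0̂ → (j ≡ c0̂) ⊎ (j ≡ c1)
⊑-from-0̂ ⊑-refl e   = inj₁ e
⊑-from-0̂ 0⊑     ()
⊑-from-0̂ 0̂⊑1    refl = inj₂ refl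

_≼_ : ∀ {n} → Colouring n → Colouring n → Set
f ≼ g = ∀ w → f w ⊑ g w

update-mono : ∀ {n} (f : Colouring n) (v : Fin n) {i j : Colour} →
  i ⊑ j → update f v i ≼ update f v j
update-mono f v i⊑j w with w ≟ v
... | yes _ = i⊑j
... | no  _ = ⊑-refl

update-cases : ∀ {n} (f : Colouring n) (v : Fin n) (i j : Colour) (w : Fin n) →
  (w ≡ v × update f v i w ≡ i) ⊎ (update f v i w ≡ update f v j w)
update-cases f v i j w with w ≟ v
... | yes w≡v = inj₁ (w≡v , refl)
... | no  _   = inj₂ refl

member-simDominated : ∀ {n} (G : Graph n) (S : Subset n) {w : Fin n} →
  w ∈ S → SimDominated G S w
member-simDominated G S w∈S _ _ = inj₁ w∈S

respecting-antitone : ∀ {n} (G : Graph n) {f g : Colouring n} (S : Subset n) →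
  f ≼ g → Respecting G g S → Respecting G f S
respecting-antitone G {f} {g} S f≼g (ones , hats) = ones′ , hats′
  where
  ones′ : ∀ w → f w ≡ c1 → w ∈ S
  ones′ w fw≡1 = ones w (⊑-from-1 (f≼g w) fw≡1)

  hats′ : ∀ w → f w ≡ c0̂ → SimDominated G S w
  hats′ w fw≡0̂ with ⊑-from-0̂ (f≼g w) fw≡0̂
  ... | inj₁ gw≡0̂ = hats w gw≡0̂
  ... | inj₂ gw≡1 = member-simDominated G S (ones w gw≡1)

minimum-mono : ∀ {n} (G : Graph n) {f g : Colouring n} {S T : Subset n} →
  f ≼ g → IsMinimumRespecting G f S → IsMinimumRespecting G g T → ∣ S ∣ ≤ ∣ T ∣
minimum-mono G {T = T} f≼g (_ , S-min) (T-resp , _) =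
  S-min T (respecting-antitone G T f≼g T-resp)

simDominated-mono : ∀ {n} (G : Graph n) {S S′ : Subset n} {w : Fin n} →
  S ⊆ S′ → SimDominated G S w → SimDominated G S′ w
simDominated-mono G S⊆S′ dom T T-span with dom T T-span
... | inj₁ w∈S            = inj₁ (S⊆S′ w∈S)
... | inj₂ (u , wu , u∈S) = inj₂ (u , wu , S⊆S′ u∈S)

respecting-add : ∀ {n} (G : Graph n) (f : Colouring n) (v : Fin n) (i : Colour)
  (S : Subset n) → Respecting G (update f v i) S →
  Respecting G (update f v c1) (S ∪ ⁅ v ⁆)
respecting-add G f v i S (ones , hats) = ones′ , hats′
  where
  S⊆S∪v : S ⊆ S ∪ ⁅ v ⁆
  S⊆S∪v = p⊆p∪q ⁅ v ⁆

  ones′ : ∀ w → update f v c1 w ≡ c1 → w ∈ S ∪ ⁅ v ⁆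
  ones′ w e with update-cases f v c1 i w
  ... | inj₁ (refl , _) = x∈p∪q⁺ (inj₂ (x∈⁅x⁆ w))
  ... | inj₂ same       = S⊆S∪v (ones w (trans (sym same) e))

  hats′ : ∀ w → update f v c1 w ≡ c0̂ → SimDominated G (S ∪ ⁅ v ⁆) w
  hats′ w e with update-cases f v c1 i w
  ... | inj₁ (_ , at-v) with () ← trans (sym at-v) e
  hats′ w e | inj₂ same = simDominated-mono G S⊆S∪v (hats w (trans (sym same) e))

∣p∪q∣≤∣p∣+∣q∣ : ∀ {n} (p q : Subset n) → ∣ p ∪ q ∣ ≤ ∣ p ∣ + ∣ q ∣
∣p∪q∣≤∣p∣+∣q∣ []            []            = z≤n
∣p∪q∣≤∣p∣+∣q∣ (outside ∷ p) (outside ∷ q) = ∣p∪q∣≤∣p∣+∣q∣ p q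
∣p∪q∣≤∣p∣+∣q∣ (inside ∷ p)  (outside ∷ q) = s≤s (∣p∪q∣≤∣p∣+∣q∣ p q)
∣p∪q∣≤∣p∣+∣q∣ (outside ∷ p) (inside ∷ q)  =
  ≤-trans (s≤s (∣p∪q∣≤∣p∣+∣q∣ p q)) (≤-reflexive (sym (+-suc ∣ p ∣ ∣ q ∣)))
∣p∪q∣≤∣p∣+∣q∣ (inside ∷ p)  (inside ∷ q)  =
  s≤s (≤-trans (∣p∪q∣≤∣p∣+∣q∣ p q) (+-monoʳ-≤ ∣ p ∣ (n≤1+n ∣ q ∣)))

∣p∪⁅x⁆∣≤∣p∣+1 : ∀ {n} (p : Subset n) (x : Fin n) → ∣ p ∪ ⁅ x ⁆ ∣ ≤ ∣ p ∣ + 1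
∣p∪⁅x⁆∣≤∣p∣+1 p x = subst (λ k → ∣ p ∪ ⁅ x ⁆ ∣ ≤ ∣ p ∣ + k) (∣⁅x⁆∣≡1 x) (∣p∪q∣≤∣p∣+∣q∣ p ⁅ x ⁆)

lemma8 : {n : ℕ} (G : Graph n) → TwoConnected G →
    (v : Fin n) (f : Colouring n) (S₁ S₀ S₀̂ : Subset n) →
    IsMinimumRespecting G (update f v c1) S₁ →
    IsMinimumRespecting G (update f v c0) S₀ →
    IsMinimumRespecting G (update f v c0̂) S₀̂ →
    ((∣ S₀ ∣ ≤ ∣ S₀̂ ∣) × (∣ S₀̂ ∣ ≤ ∣ S₁ ∣)) × (∣ S₁ ∣ ∸ ∣ S₀ ∣ ≤ 1)
lemma8 G _ v f S₁ S₀ S₀̂ min₁ min₀ min₀̂ = (S₀≤S₀̂ , S₀̂≤S₁) , S₁∸S₀≤1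
  where
  S₀≤S₀̂ : ∣ S₀ ∣ ≤ ∣ S₀̂ ∣
  S₀≤S₀̂ = minimum-mono G (update-mono f v 0⊑) min₀ min₀̂

  S₀̂≤S₁ : ∣ S₀̂ ∣ ≤ ∣ S₁ ∣
  S₀̂≤S₁ = minimum-mono G (update-mono f v 0̂⊑1) min₀̂ min₁

  -- S₀ ∪ ⁅ v ⁆ respects f_{v=1}, so S₁ is no larger than it.
  S₁≤S₀+1 : ∣ S₁ ∣ ≤ ∣ S₀ ∣ + 1
  S₁≤S₀+1 = ≤-trans (proj₂ min₁ (S₀ ∪ ⁅ v ⁆) (respecting-add G f v c0 S₀ (proj₁ min₀)))
                    (∣p∪⁅x⁆∣≤∣p∣+1 S₀ v)

  S₁∸S₀≤1 : ∣ S₁ ∣ ∸ ∣ S₀ ∣ ≤ 1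
  S₁∸S₀≤1 = m≤n+o⇒m∸n≤o ∣ S₁ ∣ ∣ S₀ ∣ S₁≤S₀+1
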